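{- For $n,k\ge 2$, let $a_{n,k}$ be the number of bargraphs of semiperimeter $n$ whose first descent has length $k$. Then $$a_{n,k}=a_{n-1,k}+a_{n-1,k-1}.$$
   Context: A bargraph is a lattice path with steps $U=(0,1)$, $H=(1,0)$, $D=(0,-1)$, identified with its word over $\{U,H,D\}$, that starts at the origin, ends on the $x$-axis, stays strictly above the $x$-axis except at its endpoints, and contains no two consecutive steps $UD$ or $DU$ (the empty path is not a bargraph). Its semiperimeter is its number of $U$ steps plus its number of $H$ steps. A descent is a maximal run of consecutive $D$ steps; the first descent is the leftmost one. $a_{n,k}$ is defined for all integers $n,k\ge1$ (being $0$ when there are no such bargraphs). -}

module Defs where

open import Data.Nat using (ℕ; zero; suc; _+_; _*_; _≡ᵇ_)
open import Data.Bool using (Bool; true; false; _∧_; not)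
open import Data.List using (List; []; _∷_; length; filter; concatMap; upTo; map)

-- Steps U = (0,1), H = (1,0), D = (0,-1); a path is its word.
data Step : Set where
  U H D : Step

wordsOfLength : ℕ → List (List Step)
wordsOfLength zero    = [] ∷ []
wordsOfLength (suc m) = concatMap (λ w → (U ∷ w) ∷ (H ∷ w) ∷ (D ∷ w) ∷ []) (wordsOfLength m)

wordsUpTo : ℕ → List (List Step)
wordsUpTo m = concatMap wordsOfLength (upTo (suc m))

-- height after one step from height h; nothing (false flag) when going below 0
-- stays h h s : walks the word from height h; every point reached except the
-- last must have height ≥ 1, the last point must have height 0.
heightOK : ℕ → List Step → Bool
heightOK h [] = false                      -- not reached for nonempty words
heightOK h (U ∷ [])     = false            -- would end at h+1 ≥ 1
heightOK h (H ∷ [])     = h ≡ᵇ 0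
heightOK zero (D ∷ [])  = false
heightOK (suc h) (D ∷ []) = h ≡ᵇ 0
heightOK h (U ∷ s ∷ r)  = heightOK (suc h) (s ∷ r)
heightOK zero (H ∷ s ∷ r) = false          -- intermediate point on the x-axis
heightOK (suc h) (H ∷ s ∷ r) = heightOK (suc h) (s ∷ r)
heightOK zero (D ∷ s ∷ r) = false
heightOK (suc zero) (D ∷ s ∷ r) = false    -- intermediate point on the x-axis
heightOK (suc (suc h)) (D ∷ s ∷ r) = heightOK (suc h) (s ∷ r)

noUDDU : List Step → Bool
noUDDU (U ∷ D ∷ r) = false
noUDDU (D ∷ U ∷ r) = false
noUDDU (_ ∷ r)     = noUDDU r
noUDDU []          = true

isBargraph : List Step → Bool
isBargraph [] = false
isBargraph w@(_ ∷ _) = heightOK 0 w ∧ noUDDU w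

semiperimeter : List Step → ℕ
semiperimeter [] = 0
semiperimeter (U ∷ r) = suc (semiperimeter r)
semiperimeter (H ∷ r) = suc (semiperimeter r)
semiperimeter (D ∷ r) = semiperimeter r

leadingDs : List Step → ℕ
leadingDs (D ∷ r) = suc (leadingDs r)
leadingDs _       = 0

firstDescent : List Step → ℕ
firstDescent [] = 0
firstDescent (D ∷ r) = leadingDs (D ∷ r)
firstDescent (_ ∷ r) = firstDescent r

counted : ℕ → ℕ → List Step → Bool
counted n k w = isBargraph w ∧ (semiperimeter w ≡ᵇ n) ∧ (firstDescent w ≡ᵇ k)

-- A bargraph has as many D as U steps, so its length is 2#U + #H ≤ 2n;
-- hence enumerating all words of length ≤ 2n is exhaustive.
a : ℕ → ℕ → ℕ
a n k = length (filter (λ w → Data.Bool.T? (counted n k w)) (wordsUpTo (2 * n)))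

-- A bargraph counted by a (n, k) factors at its first descent as Q x H D r with Q x free of D:
-- the H is the last roof step of the first peak. If x = H that roof is at least two steps wide, and
-- deleting one roof step (inverse: inserting H before the first descent) is a bijection onto the
-- bargraphs counted by a (n-1, k). If x = U then, as k ≥ 2, the word is Q U H D D r′, and
-- U H D D ↦ H D (inverse: H D ↦ U H D D) is a bijection onto those counted by a (n-1, k-1).
-- Both rewrites are local: old and new segment start with U or H, change the height by the same
-- amount and never go below their final height, so the bargraph conditions are unaffected. The
-- counts are taken in a duplicate-free enumeration of all words of length at most 2n, where
-- bijections preserve cardinality.
module Submission where

open import Defs
open import Data.Nat using (ℕ; zero; suc; _+_; _*_; _∸_; _≤_; z≤n; s≤s; _≡ᵇ_)
open import Data.Bool using (Bool; true; false; T; T?; not; _∧_)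
open import Data.Bool.Properties using (T-∧)
open import Data.Empty using (⊥-elim)
open import Data.Unit using (tt)
open import Data.List using (List; []; _∷_; _++_; length; map; filter; upTo)
open import Data.List.Membership.Propositional using (_∈_)
open import Data.List.Membership.Propositional.Properties
  using (∈-map⁺; ∈-map⁻; ∈-concat⁺′; ∈-concat⁻′; ∈-upTo⁺; ∈-upTo⁻; ∈-filter⁺; ∈-filter⁻)
open import Data.List.Membership.Propositional.Properties.WithK using (unique∧set⇒bag)
open import Data.List.Properties using (length-map; map-∘; map-id-local)
open import Data.List.Relation.Binary.BagAndSetEquality using (∼bag⇒↭)
open import Data.List.Relation.Binary.Disjoint.Propositional using (Disjoint)
open import Data.List.Relation.Binary.Permutation.Propositional.Properties using (↭-length)
open import Data.List.Relation.Unary.All as All using (All; []; _∷_)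
import Data.List.Relation.Unary.All.Properties as All
open import Data.List.Relation.Unary.AllPairs as AllPairs using ([]; _∷_)
import Data.List.Relation.Unary.AllPairs.Properties as AllPairs
open import Data.List.Relation.Unary.Any using (here; there)
open import Data.List.Relation.Unary.Unique.Propositional using (Unique)
import Data.List.Relation.Unary.Unique.Propositional.Properties as Unique
open import Data.Nat.Properties
  using (0≢1+n; ≤-trans; n≤1+n; m≤n+m; +-suc; *-suc; suc-injective; +-cancelˡ-≡; ≡ᵇ⇒≡; ≡⇒≡ᵇ)
open import Data.Product using (Σ; _×_; _,_; proj₁; proj₂)
open import Function using (_∘_; _⇔_; mk⇔; Equivalence)
open import Relation.Binary.PropositionalEquality
  using (_≡_; _≢_; refl; sym; trans; cong; cong₂; subst; module ≡-Reasoning)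

private
  variable
    A B : Set
    n k d : ℕ
    x y : Step
    w Q X Y : List Step

-- Counting by bijections

count : (A → Bool) → List A → ℕ
count p xs = length (filter (λ x → T? (p x)) xs)

count-split : ∀ (p c : A → Bool) xs →
  count p xs ≡ count (λ x → p x ∧ c x) xs + count (λ x → p x ∧ not (c x)) xs
count-split p c [] = refl
count-split p c (x ∷ xs) with p x | c x
... | false | _     = count-split p c xs
... | true  | true  = cong suc (count-split p c xs)
... | true  | false = trans (cong suc (count-split p c xs)) (sym (+-suc _ _))

unique∧inverse⇒length≡ : ∀ {xs : List A} {ys : List B} (f : A → B) (g : B → A) →
  Unique xs → Unique ys →
  (∀ {x} → x ∈ xs → f x ∈ ys × g (f x) ≡ x) →
  (∀ {y} → y ∈ ys → g y ∈ xs × f (g y) ≡ y) →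
  length xs ≡ length ys
unique∧inverse⇒length≡ {xs = xs} {ys} f g xs! ys! to from = begin
  length xs         ≡⟨ sym (length-map f xs) ⟩
  length (map f xs) ≡⟨ ↭-length (∼bag⇒↭ (unique∧set⇒bag fxs! ys! (mk⇔ into onto))) ⟩
  length ys         ∎
  where
  open ≡-Reasoning
  map-g-map-f : map g (map f xs) ≡ xs
  map-g-map-f = trans (sym (map-∘ xs)) (map-id-local {f = g ∘ f} (All.tabulate (proj₂ ∘ to)))
  fxs! : Unique (map f xs)
  fxs! = Unique.map⁻ {f = g} (subst Unique (sym map-g-map-f) xs!)
  into : ∀ {y} → y ∈ map f xs → y ∈ ys
  into y∈ with x , x∈ , refl ← ∈-map⁻ f y∈ = proj₁ (to x∈)
  onto : ∀ {y} → y ∈ ys → y ∈ map f xs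
  onto y∈ = subst (_∈ map f xs) (proj₂ (from y∈)) (∈-map⁺ f (proj₁ (from y∈)))

-- Enumerating words

extend : List Step → List (List Step)
extend w = (U ∷ w) ∷ (H ∷ w) ∷ (D ∷ w) ∷ []

∈-extend⁻ : ∀ {v} → v ∈ extend w → Σ Step λ s → v ≡ s ∷ w
∈-extend⁻ (here refl)                 = U , refl
∈-extend⁻ (there (here refl))         = H , refl
∈-extend⁻ (there (there (here refl))) = D , refl

∈-extend⁺ : ∀ s → (s ∷ w) ∈ extend w
∈-extend⁺ U = here refl
∈-extend⁺ H = there (here refl)
∈-extend⁺ D = there (there (here refl))

∈-wordsOfLength⁻ : ∀ m → w ∈ wordsOfLength m → length w ≡ m
∈-wordsOfLength⁻ zero    (here refl) = refl
∈-wordsOfLength⁻ (suc m) w∈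
  with v , w∈v , v∈ ← ∈-concat⁻′ (map extend (wordsOfLength m)) w∈
  with u , u∈ , refl ← ∈-map⁻ extend v∈
  with _ , refl ← ∈-extend⁻ w∈v
  = cong suc (∈-wordsOfLength⁻ m u∈)

∈-wordsOfLength⁺ : ∀ w → w ∈ wordsOfLength (length w)
∈-wordsOfLength⁺ []      = here refl
∈-wordsOfLength⁺ (s ∷ w) = ∈-concat⁺′ (∈-extend⁺ s) (∈-map⁺ extend (∈-wordsOfLength⁺ w))

∈-wordsUpTo⁻ : ∀ N → w ∈ wordsUpTo N → length w ≤ N
∈-wordsUpTo⁻ N w∈
  with v , w∈v , v∈ ← ∈-concat⁻′ (map wordsOfLength (upTo (suc N))) w∈
  with m , m∈ , refl ← ∈-map⁻ wordsOfLength v∈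
  with s≤s m≤N ← ∈-upTo⁻ m∈
  = subst (_≤ N) (sym (∈-wordsOfLength⁻ m w∈v)) m≤N

∈-wordsUpTo⁺ : ∀ N → length w ≤ N → w ∈ wordsUpTo N
∈-wordsUpTo⁺ {w} N w≤N =
  ∈-concat⁺′ (∈-wordsOfLength⁺ w) (∈-map⁺ wordsOfLength (∈-upTo⁺ (s≤s w≤N)))

unique-extend : ∀ w → Unique (extend w)
unique-extend w = ((λ ()) ∷ (λ ()) ∷ []) ∷ ((λ ()) ∷ []) ∷ [] ∷ []

unique-wordsOfLength : ∀ m → Unique (wordsOfLength m)
unique-wordsOfLength zero    = [] ∷ []
unique-wordsOfLength (suc m) = Unique.concat⁺
  (All.map⁺ (All.universal unique-extend (wordsOfLength m)))
  (AllPairs.map⁺ {f = extend} (AllPairs.map disjoint (unique-wordsOfLength m)))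
  where
  disjoint : ∀ {u v} → u ≢ v → Disjoint (extend u) (extend v)
  disjoint u≢v (p , q) with _ , refl ← ∈-extend⁻ p | _ , refl ← ∈-extend⁻ q = u≢v refl

unique-wordsUpTo : ∀ N → Unique (wordsUpTo N)
unique-wordsUpTo N = Unique.concat⁺
  (All.map⁺ (All.universal unique-wordsOfLength (upTo (suc N))))
  (AllPairs.map⁺ {f = wordsOfLength} (AllPairs.map disjoint (Unique.upTo⁺ (suc N))))
  where
  disjoint : ∀ {l m} → l ≢ m → Disjoint (wordsOfLength l) (wordsOfLength m)
  disjoint l≢m (p , q) = l≢m (trans (sym (∈-wordsOfLength⁻ _ p)) (∈-wordsOfLength⁻ _ q))

transfer-∈-filter : ∀ {p q : List Step → Bool} N M (f g : List Step → List Step) →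
  (∀ {w} → T (q w) → length w ≤ M) →
  (∀ {w} → T (p w) → T (q (f w)) × g (f w) ≡ w) →
  w ∈ filter (λ v → T? (p v)) (wordsUpTo N) →
  f w ∈ filter (λ v → T? (q v)) (wordsUpTo M) × g (f w) ≡ w
transfer-∈-filter {p = p} {q} N M f g q-bounded f-into w∈
  with _ , pw ← ∈-filter⁻ (λ v → T? (p v)) {xs = wordsUpTo N} w∈
  with qfw , gfw≡w ← f-into pw
  = ∈-filter⁺ (λ v → T? (q v)) (∈-wordsUpTo⁺ M (q-bounded qfw)) qfw , gfw≡w

count-bijection : ∀ (p q : List Step → Bool) N M (f g : List Step → List Step) →
  (∀ {w} → T (p w) → length w ≤ N) →
  (∀ {w} → T (q w) → length w ≤ M) →
  (∀ {w} → T (p w) → T (q (f w)) × g (f w) ≡ w) →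
  (∀ {w} → T (q w) → T (p (g w)) × f (g w) ≡ w) →
  count p (wordsUpTo N) ≡ count q (wordsUpTo M)
count-bijection p q N M f g p-bounded q-bounded f-into g-into = unique∧inverse⇒length≡ f g
  (Unique.filter⁺ (λ v → T? (p v)) (unique-wordsUpTo N))
  (Unique.filter⁺ (λ v → T? (q v)) (unique-wordsUpTo M))
  (transfer-∈-filter N M f g q-bounded f-into) (transfer-∈-filter M N g f p-bounded g-into)

-- Local rewriting of bargraphs

data NotDown : Step → Set where
  up   : NotDown U
  flat : NotDown H

data Rising : List Step → Set where
  rising : NotDown x → NotDown y → Rising (x ∷ y ∷ X)

rising-++ : All NotDown Q → Rising X → Rising (Q ++ X)
rising-++ []             r             = r
rising-++ (nq ∷ [])      (rising nx _) = rising nq nx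
rising-++ (nq ∷ nq′ ∷ _) _             = rising nq nq′

record Counted (n k : ℕ) (w : List Step) : Set where
  constructor counted✓
  field
    bargraph       : T (isBargraph w)
    semiperimeter≡ : semiperimeter w ≡ n
    firstDescent≡  : firstDescent w ≡ k
open Counted

T-counted : T (counted n k w) ⇔ Counted n k w
T-counted {n} {k} {w} = mk⇔
  (λ c → let b , sf = to (T-∧ {isBargraph w}) c
             s , f  = to (T-∧ {semiperimeter w ≡ᵇ n}) sf
         in counted✓ b (≡ᵇ⇒≡ _ _ s) (≡ᵇ⇒≡ _ _ f))
  (λ (counted✓ b s f) → from (T-∧ {isBargraph w})
     (b , from (T-∧ {semiperimeter w ≡ᵇ n}) (≡⇒≡ᵇ _ _ s , ≡⇒≡ᵇ _ _ f)))
  where open Equivalence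

T-counted-∧ : ∀ {b} → T (counted n k w ∧ b) ⇔ (Counted n k w × T b)
T-counted-∧ {n} {k} {w} = mk⇔
  (λ p → let c , t = to (T-∧ {counted n k w}) p in to T-counted c , t)
  (λ (c , t) → from (T-∧ {counted n k w}) (from T-counted c , t))
  where open Equivalence

+-2*suc : ∀ h m → h + 2 * suc m ≡ suc (suc (h + 2 * m))
+-2*suc h m = trans (cong (h +_) (*-suc 2 m)) (trans (+-suc h _) (cong suc (+-suc h _)))

-- A path from height h that ends on the axis has h + #U down steps.
heightOK⇒length≤ : ∀ h w → T (heightOK h w) → length w ≤ h + 2 * semiperimeter w
heightOK⇒length≤ h             (H ∷ [])    _  = ≤-trans (s≤s z≤n) (m≤n+m 2 h)
heightOK⇒length≤ (suc h)       (D ∷ [])    _  = s≤s z≤n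
heightOK⇒length≤ h             (U ∷ s ∷ r) ok =
  subst (suc (length (s ∷ r)) ≤_) (sym (+-2*suc h _)) (s≤s (heightOK⇒length≤ (suc h) (s ∷ r) ok))
heightOK⇒length≤ (suc h)       (H ∷ s ∷ r) ok =
  subst (suc (length (s ∷ r)) ≤_) (sym (+-2*suc (suc h) _))
        (s≤s (≤-trans (heightOK⇒length≤ (suc h) (s ∷ r) ok) (n≤1+n _)))
heightOK⇒length≤ (suc (suc h)) (D ∷ s ∷ r) ok = s≤s (heightOK⇒length≤ (suc h) (s ∷ r) ok)
heightOK⇒length≤ zero          (D ∷ [])    ()
heightOK⇒length≤ zero          (H ∷ _ ∷ _) ()
heightOK⇒length≤ zero          (D ∷ _ ∷ _) ()
heightOK⇒length≤ (suc zero)    (D ∷ _ ∷ _) ()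

bargraph⇒heightOK : T (isBargraph (x ∷ w)) → T (heightOK 0 (x ∷ w))
bargraph⇒heightOK {x} {w} b = proj₁ (Equivalence.to (T-∧ {heightOK 0 (x ∷ w)}) b)

bargraph⇒noUDDU : T (isBargraph (x ∷ w)) → T (noUDDU (x ∷ w))
bargraph⇒noUDDU {x} {w} b = proj₂ (Equivalence.to (T-∧ {heightOK 0 (x ∷ w)}) b)

counted⇒length≤ : Counted n k w → length w ≤ 2 * n
counted⇒length≤ {w = x ∷ w} (counted✓ b refl _) = heightOK⇒length≤ 0 (x ∷ w) (bargraph⇒heightOK {x} {w} b)

noUDDU-skip : ∀ {z} → NotDown y → NotDown z → noUDDU (y ∷ z ∷ w) ≡ noUDDU (z ∷ w)
noUDDU-skip up   up   = refl
noUDDU-skip up   flat = refl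
noUDDU-skip flat up   = refl
noUDDU-skip flat flat = refl

noUDDU-∷-cong : ∀ {a b} → NotDown y → NotDown a → NotDown b →
  noUDDU (a ∷ X) ≡ noUDDU (b ∷ Y) → noUDDU (y ∷ a ∷ X) ≡ noUDDU (y ∷ b ∷ Y)
noUDDU-∷-cong ny na nb eq = trans (noUDDU-skip ny na) (trans eq (sym (noUDDU-skip ny nb)))

-- Heads that are not D keep the UD/DU patterns from straddling the junction with a D-free prefix.
data Shrink (d : ℕ) : List Step → List Step → Set where
  shrink : ∀ {a b} {X Y : List Step} → NotDown a → NotDown b →
    (∀ h → heightOK h (a ∷ X) ≡ heightOK h (b ∷ Y)) →
    noUDDU (a ∷ X) ≡ noUDDU (b ∷ Y) →
    semiperimeter (a ∷ X) ≡ suc (semiperimeter (b ∷ Y)) →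
    firstDescent (a ∷ X) ≡ d + firstDescent (b ∷ Y) →
    Shrink d (a ∷ X) (b ∷ Y)

shrink-∷ : NotDown y → Shrink d X Y → Shrink d (y ∷ X) (y ∷ Y)
shrink-∷ up   (shrink na nb hgt nud sp fd) =
  shrink up up (hgt ∘ suc) (noUDDU-∷-cong up na nb nud) (cong suc sp) fd
shrink-∷ flat (shrink na nb hgt nud sp fd) =
  shrink flat flat (λ { zero → refl ; (suc h) → hgt (suc h) }) (noUDDU-∷-cong flat na nb nud) (cong suc sp) fd

shrink-++ : All NotDown Q → Shrink d X Y → Shrink d (Q ++ X) (Q ++ Y)
shrink-++ []        s = s
shrink-++ (nq ∷ dq) s = shrink-∷ nq (shrink-++ dq s)

shrink-Counted : Shrink d X Y → Counted (suc n) (d + k) X ⇔ Counted n k Y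
shrink-Counted {d} (shrink {a} {b} {X} {Y} _ _ hgt nud sp fd) = mk⇔
  (λ (counted✓ bar s f) → counted✓ (subst T bar≡ bar) (suc-injective (trans (sym sp) s))
                                     (+-cancelˡ-≡ d _ _ (trans (sym fd) f)))
  (λ (counted✓ bar s f) → counted✓ (subst T (sym bar≡) bar) (trans sp (cong suc s))
                                     (trans fd (cong (d +_) f)))
  where
  bar≡ : isBargraph (a ∷ X) ≡ isBargraph (b ∷ Y)
  bar≡ = cong₂ _∧_ (hgt 0) nud

narrowing : ∀ r → Shrink 0 (H ∷ H ∷ D ∷ r) (H ∷ D ∷ r)
narrowing r = shrink flat flat (λ { zero → refl ; (suc h) → refl }) refl refl refl

lowering : ∀ r → Shrink 1 (U ∷ H ∷ D ∷ D ∷ r) (H ∷ D ∷ r)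
lowering r = shrink up flat (λ { zero → refl ; (suc h) → refl }) refl refl refl

-- The first peak

atDescent : (Step → List Step → List Step) → List Step → List Step
atDescent F (x ∷ D ∷ r) = F x (D ∷ r)
atDescent F (x ∷ r)     = x ∷ atDescent F r
atDescent F []          = []

narrowRoof widenRoof raiseRoof : List Step → List Step
narrowRoof = atDescent (λ _ r → r)
widenRoof  = atDescent (λ x r → x ∷ H ∷ r)
raiseRoof  = atDescent (λ x r → U ∷ x ∷ D ∷ r)

lowerRoof : List Step → List Step
lowerRoof (x ∷ y ∷ D ∷ r) = y ∷ r
lowerRoof (x ∷ r)         = x ∷ lowerRoof r
lowerRoof []              = []

isH : Step → Bool
isH H = true
isH _ = false

wideRoof : List Step → Bool
wideRoof (x ∷ y ∷ D ∷ r) = isH x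
wideRoof (x ∷ r)         = wideRoof r
wideRoof []              = false

atDescent-skip : ∀ F {q} → NotDown y → atDescent F (q ∷ y ∷ w) ≡ q ∷ atDescent F (y ∷ w)
atDescent-skip F up   = refl
atDescent-skip F flat = refl

atDescent-++ : ∀ F → All NotDown Q → NotDown x → atDescent F (Q ++ x ∷ X) ≡ Q ++ atDescent F (x ∷ X)
atDescent-++ F []                    _  = refl
atDescent-++ F (_ ∷ [])              nx = atDescent-skip F nx
atDescent-++ F (_∷_ {q} _ (nq ∷ dq)) nx =
  trans (atDescent-skip F nq) (cong (q ∷_) (atDescent-++ F (nq ∷ dq) nx))

lowerRoof-++ : All NotDown Q → Rising X → lowerRoof (Q ++ X) ≡ Q ++ lowerRoof X
lowerRoof-++ []             _  = refl
lowerRoof-++ (_∷_ {q} _ dq) rx = trans (skip (rising-++ dq rx)) (cong (q ∷_) (lowerRoof-++ dq rx))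
  where
  skip : Rising w → lowerRoof (q ∷ w) ≡ q ∷ lowerRoof w
  skip (rising _ up)   = refl
  skip (rising _ flat) = refl

wideRoof-++ : All NotDown Q → Rising X → wideRoof (Q ++ X) ≡ wideRoof X
wideRoof-++ []             _  = refl
wideRoof-++ (_∷_ {q} _ dq) rx = trans (skip (rising-++ dq rx)) (wideRoof-++ dq rx)
  where
  skip : Rising w → wideRoof (q ∷ w) ≡ wideRoof w
  skip (rising _ up)   = refl
  skip (rising _ flat) = refl

firstDescent-++ : All NotDown Q → firstDescent (Q ++ X) ≡ firstDescent X
firstDescent-++ []          = refl
firstDescent-++ (up ∷ dq)   = firstDescent-++ dq
firstDescent-++ (flat ∷ dq) = firstDescent-++ dq

data PeakView : List Step → Set where
  peak : All NotDown Q → NotDown x → ∀ r → PeakView (Q ++ x ∷ H ∷ D ∷ r)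

peakView-∷ : NotDown y → PeakView w → PeakView (y ∷ w)
peakView-∷ ny (peak dq nx r) = peak (ny ∷ dq) nx r

peakView-rising : ∀ {z} → NotDown y → NotDown z → ∀ s →
  T (noUDDU (y ∷ z ∷ s)) → firstDescent (y ∷ z ∷ s) ≡ suc k → PeakView (y ∷ z ∷ s)
peakView-rising ny nz   []      _  fd = ⊥-elim (0≢1+n (trans (sym (firstDescent-++ (ny ∷ nz ∷ []))) fd))
peakView-rising ny up   (D ∷ r) ok _  = ⊥-elim (subst T (noUDDU-skip ny up) ok)
peakView-rising ny flat (D ∷ r) _  _  = peak [] ny r
peakView-rising ny nz   (U ∷ s) ok fd = peakView-∷ ny
  (peakView-rising nz up s (subst T (noUDDU-skip ny nz) ok) (trans (sym (firstDescent-++ (ny ∷ []))) fd))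
peakView-rising ny nz   (H ∷ s) ok fd = peakView-∷ ny
  (peakView-rising nz flat s (subst T (noUDDU-skip ny nz) ok) (trans (sym (firstDescent-++ (ny ∷ []))) fd))

peakView : T (isBargraph w) → firstDescent w ≡ suc k → PeakView w
peakView {U ∷ U ∷ s} b  fd = peakView-rising up up   s (bargraph⇒noUDDU {U} {U ∷ s} b) fd
peakView {U ∷ H ∷ s} b  fd = peakView-rising up flat s (bargraph⇒noUDDU {U} {H ∷ s} b) fd
peakView {U ∷ D ∷ s} b  _  = ⊥-elim (bargraph⇒noUDDU {U} {D ∷ s} b)
peakView {H ∷ []}    _  ()
peakView {[]}        () _
peakView {U ∷ []}    () _
peakView {H ∷ _ ∷ _} () _
peakView {D ∷ []}    () _
peakView {D ∷ _ ∷ _} () _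

narrowRoof-counted : Counted (suc n) (suc k) w → T (wideRoof w) →
  Counted n (suc k) (narrowRoof w) × widenRoof (narrowRoof w) ≡ w
narrowRoof-counted {w = w} c wide with peakView {w} (bargraph c) (firstDescent≡ c)
... | peak dq up   r = ⊥-elim (subst T (wideRoof-++ dq (rising up flat)) wide)
... | peak {Q} dq flat r =
  subst (Counted _ _) (sym narrowed) (Equivalence.to (shrink-Counted (shrink-++ dq (narrowing r))) c) ,
  trans (cong widenRoof narrowed) (atDescent-++ _ dq flat)
  where
  narrowed : narrowRoof (Q ++ H ∷ H ∷ D ∷ r) ≡ Q ++ H ∷ D ∷ r
  narrowed = atDescent-++ _ dq flat

widenRoof-counted : Counted n (suc k) w →
  (Counted (suc n) (suc k) (widenRoof w) × T (wideRoof (widenRoof w))) × narrowRoof (widenRoof w) ≡ w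
widenRoof-counted {w = w} c with peakView {w} (bargraph c) (firstDescent≡ c)
... | peak {Q} {x} dq nx r =
  ( subst (Counted _ _) (sym widened) (Equivalence.from (shrink-Counted (shrink-++ dq (shrink-∷ nx (narrowing r)))) c)
  , subst T (sym (trans (cong wideRoof widened) (wideRoof-++ dq (rising nx flat)))) tt ) ,
  trans (cong narrowRoof widened) (atDescent-++ _ dq nx)
  where
  widened : widenRoof (Q ++ x ∷ H ∷ D ∷ r) ≡ Q ++ x ∷ H ∷ H ∷ D ∷ r
  widened = atDescent-++ _ dq nx

leadingDs≡suc : ∀ r → leadingDs r ≡ suc k → Σ (List Step) λ r′ → r ≡ D ∷ r′
leadingDs≡suc (D ∷ r) _ = r , refl

lowerRoof-counted : Counted (suc n) (suc (suc k)) w → T (not (wideRoof w)) →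
  Counted n (suc k) (lowerRoof w) × raiseRoof (lowerRoof w) ≡ w
lowerRoof-counted {w = w} c narrow with peakView {w} (bargraph c) (firstDescent≡ c)
... | peak dq flat r = ⊥-elim (subst (T ∘ not) (wideRoof-++ dq (rising flat flat)) narrow)
... | peak {Q} dq up r
  with r′ , refl ← leadingDs≡suc r (suc-injective (trans (sym (firstDescent-++ dq)) (firstDescent≡ c)))
  = subst (Counted _ _) (sym lowered) (Equivalence.to (shrink-Counted (shrink-++ dq (lowering r′))) c) ,
    trans (cong raiseRoof lowered) (atDescent-++ _ dq flat)
  where
  lowered : lowerRoof (Q ++ U ∷ H ∷ D ∷ D ∷ r′) ≡ Q ++ H ∷ D ∷ r′
  lowered = lowerRoof-++ dq (rising up flat)

raiseRoof-counted : Counted n (suc k) w →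
  (Counted (suc n) (suc (suc k)) (raiseRoof w) × T (not (wideRoof (raiseRoof w)))) × lowerRoof (raiseRoof w) ≡ w
raiseRoof-counted {w = w} c with peakView {w} (bargraph c) (firstDescent≡ c)
... | peak {Q} {x} dq nx r =
  ( subst (Counted _ _) (sym raised) (Equivalence.from (shrink-Counted (shrink-++ dq (shrink-∷ nx (lowering r)))) c)
  , subst (T ∘ not) (sym (trans (cong wideRoof raised) (wideRoof-++ dq (rising nx up)))) tt ) ,
  trans (cong lowerRoof raised) (lowerRoof-++ dq (rising nx up))
  where
  raised : raiseRoof (Q ++ x ∷ H ∷ D ∷ r) ≡ Q ++ x ∷ U ∷ H ∷ D ∷ D ∷ r
  raised = atDescent-++ _ dq nx

count-bijection-counted : ∀ {n k n′ k′} (b : List Step → Bool) (f g : List Step → List Step) →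
  (∀ {w} → Counted n k w → T (b w) → Counted n′ k′ (f w) × g (f w) ≡ w) →
  (∀ {w} → Counted n′ k′ w → (Counted n k (g w) × T (b (g w))) × f (g w) ≡ w) →
  count (λ w → counted n k w ∧ b w) (wordsUpTo (2 * n)) ≡ a n′ k′
count-bijection-counted {n} {k} {n′} {k′} b f g f-into g-into =
  count-bijection (λ w → counted n k w ∧ b w) (counted n′ k′) (2 * n) (2 * n′) f g
    (λ {w} p → counted⇒length≤ (proj₁ (to (T-counted-∧ {w = w}) p)))
    (λ {w} p → counted⇒length≤ (to (T-counted {w = w}) p))
    (λ {w} p → let c , bw = to (T-counted-∧ {w = w}) p
                   c′ , inverse = f-into c bw
               in from T-counted c′ , inverse)
    (λ {w} p → let c′ , inverse = g-into (to (T-counted {w = w}) p) in from T-counted-∧ c′ , inverse)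
  where open Equivalence

mainTheorem10 : (n k : ℕ) → 2 ≤ n → 2 ≤ k → a n k ≡ a (n ∸ 1) k + a (n ∸ 1) (k ∸ 1)
mainTheorem10 (suc n) (suc (suc k)) _ _ = begin
  a (suc n) (suc (suc k))
    ≡⟨ count-split (counted (suc n) (suc (suc k))) wideRoof (wordsUpTo (2 * suc n)) ⟩
  count (λ w → counted (suc n) (suc (suc k)) w ∧ wideRoof w) (wordsUpTo (2 * suc n)) +
  count (λ w → counted (suc n) (suc (suc k)) w ∧ not (wideRoof w)) (wordsUpTo (2 * suc n))
    ≡⟨ cong₂ _+_
         (count-bijection-counted {n′ = n} {k′ = suc (suc k)}
            wideRoof narrowRoof widenRoof narrowRoof-counted widenRoof-counted)
         (count-bijection-counted {n′ = n} {k′ = suc k}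
            (not ∘ wideRoof) lowerRoof raiseRoof lowerRoof-counted raiseRoof-counted) ⟩
  a n (suc (suc k)) + a n (suc k) ∎
  where open ≡-Reasoning
mainTheorem10 (suc n) (suc zero) _ (s≤s ())
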